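{- Let $m\ge2$ be even. For all integers $a_3,\dots,a_m\ge3$, $R_{C_m}(3,3,a_3,\dots,a_m)=3$.
   Context: $C_m\le S_m$ denotes the cyclic group generated by the $m$-cycle $(1\,2\,\cdots\,m)$. An $m$-edge-coloured complete graph is a complete graph with each edge coloured from $[m]=\{1,\dots,m\}$. For $\Gamma\le S_m$, $\pi\in\Gamma$ and a vertex $v$, switching at $v$ with $\pi$ recolours every edge incident with $v$ of colour $i$ to colour $\pi(i)$, leaving other edges unchanged. Two such graphs on the same vertex set are $\Gamma$-switch equivalent if one is obtained from the other by a finite sequence of switches. $K_t^{(i)}$ is a complete graph on $t$ vertices with all edges of colour $i$. $R_\Gamma(a_1,\dots,a_m)$ is the least $n$ such that every $m$-edge-coloured complete graph on $n$ vertices is $\Gamma$-switch equivalent to one containing, for some $i$, a copy of $K_{a_i}^{(i)}$. -}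

module Defs where

open import Data.Nat using (ℕ; zero; suc; _<_; _≤_)
open import Data.Nat.DivMod using (_mod_)
open import Data.Fin using (Fin; toℕ) renaming (_≟_ to _≟ᶠ_)
open import Data.Product using (Σ; _×_)
open import Relation.Nullary using (¬_; does)
open import Relation.Binary.PropositionalEquality using (_≡_; _≢_)
open import Relation.Binary.Construct.Closure.ReflexiveTransitive using (Star)
open import Data.Bool using (_∨_; if_then_else_)
open import Function.Definitions using (Injective)

-- Colours are Fin m; paper colour j ∈ [m] corresponds to Fin index j - 1.

cycGen : ∀ {m} → Fin m → Fin m
cycGen {suc n} i = suc (toℕ i) mod suc n

-- Elements of C_m are exactly the powers cycGen^k (k : ℕ).
cycPow : ∀ {m} → ℕ → Fin m → Fin m
cycPow zero    i = i
cycPow (suc k) i = cycGen (cycPow k i)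

-- An m-edge-coloured complete graph on vertex set Fin n:
-- a symmetric colour function; the diagonal values are irrelevant.
record Colouring (m n : ℕ) : Set where
  constructor mkColouring
  field
    col : Fin n → Fin n → Fin m
    sym : ∀ x y → col x y ≡ col y x
open Colouring public

switchCol : ∀ {m n} → (Fin m → Fin m) → Fin n → (Fin n → Fin n → Fin m) → Fin n → Fin n → Fin m
switchCol π v c x y = if does (x ≟ᶠ v) ∨ does (y ≟ᶠ v) then π (c x y) else c x y

CSwitch : ∀ {m n} → Colouring m n → Colouring m n → Set
CSwitch {m} {n} c d = Σ (Fin n) λ v → Σ ℕ λ k →
  ∀ x y → x ≢ y → col d x y ≡ switchCol (cycPow k) v (col c) x y

CSwitchEquiv : ∀ {m n} → Colouring m n → Colouring m n → Set
CSwitchEquiv = Star CSwitch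

ContainsMono : ∀ {m n} → Colouring m n → (t : ℕ) → Fin m → Set
ContainsMono {m} {n} c t i = Σ (Fin t → Fin n) λ f → Injective _≡_ _≡_ f ×
  (∀ a b → a ≢ b → col c (f a) (f b) ≡ i)

CRamseyProp : ∀ {m} → (Fin m → ℕ) → ℕ → Set
CRamseyProp {m} a n = (c : Colouring m n) → Σ (Colouring m n) λ d →
  CSwitchEquiv c d × Σ (Fin m) λ i → ContainsMono d (a i) i

CRamseyIs : ∀ {m} → (Fin m → ℕ) → ℕ → Set
CRamseyIs a r = CRamseyProp a r × (∀ n → n < r → ¬ CRamseyProp a n)

-- On three vertices, switching v₀, v₁, v₂ by k₀, k₁, k₂ adds k₀ + k₁, k₀ + k₂, k₁ + k₂ (mod m)
-- to the colours x, y, z of the edges v₀v₁, v₀v₂, v₁v₂. Making all three equal to t requires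
-- 2(k₀ + k₁ + k₂) ≡ 3t − (x + y + z); choosing t ∈ {0, 1} of the right parity makes the
-- right-hand side even, and then the system is solvable. So every colouring of K₃ switches to a
-- monochromatic triangle in colour 1 or 2, giving R ≤ 3; as every aᵢ ≥ 3 and there is no
-- injection Fin 3 → Fin n for n < 3, R ≥ 3.
module Submission where

open import Defs
open import Data.Nat using (ℕ; zero; suc; _+_; _*_; _%_; _/_; _≤_; _≥_; _<_; z≤n; s≤s)
open import Data.Nat.Properties using (+-identityʳ; +-suc; ≤-reflexive; ≤-trans; <-≤-trans; ≤-<-connex; n≮n)
open import Data.Nat.DivMod using (m≡m%n+[m/n]*n; [m+kn]%n≡m%n; m<n⇒m%n≡m; m%n<n; m%n%n≡m%n; %-distribˡ-+)
open import Data.Nat.Divisibility using (_∣_)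
open import Data.Nat.Tactic.RingSolver using (solve; solve-∀)
open import Data.Fin using (Fin; zero; suc; toℕ; fromℕ<) renaming (_≟_ to _≟ᶠ_)
open import Data.Fin.Properties using (toℕ-fromℕ<; toℕ-injective; toℕ<n; pigeonhole; <-irrefl)
open import Data.Product using (_×_; _,_; ∃-syntax)
open import Data.Sum using (inj₁; inj₂)
open import Data.Bool.Properties using (∨-comm)
open import Data.List using (_∷_; [])
open import Data.Empty using (⊥-elim)
open import Relation.Nullary using (¬_; does)
open import Relation.Binary.PropositionalEquality using (_≡_; refl; trans; cong; subst; module ≡-Reasoning)
  renaming (sym to ≡-sym)
open import Relation.Binary.Construct.Closure.ReflexiveTransitive using (ε; _◅_)

cycPow-+ : ∀ {m} a b (i : Fin m) → cycPow a (cycPow b i) ≡ cycPow (b + a) i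
cycPow-+ zero    b i rewrite +-identityʳ b = refl
cycPow-+ (suc a) b i rewrite +-suc b a     = cong cycGen (cycPow-+ a b i)

suc-%-suc : ∀ a n → suc (a % suc n) % suc n ≡ suc a % suc n
suc-%-suc a n = begin
  (1 + a % N) % N                ≡⟨ %-distribˡ-+ 1 (a % N) N ⟩
  (1 % N + a % N % N) % N        ≡⟨ cong (λ r → (1 % N + r) % N) (m%n%n≡m%n a N) ⟩
  (1 % N + a % N) % N            ≡⟨ %-distribˡ-+ 1 a N ⟨
  (1 + a) % N                    ∎
  where
  open ≡-Reasoning
  N = suc n

toℕ-cycPow : ∀ {n} k (i : Fin (suc n)) → toℕ (cycPow k i) ≡ (toℕ i + k) % suc n
toℕ-cycPow zero i rewrite +-identityʳ (toℕ i) = ≡-sym (m<n⇒m%n≡m (toℕ<n i))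
toℕ-cycPow {n} (suc k) i = begin
  toℕ (cycGen (cycPow k i))          ≡⟨ toℕ-fromℕ< _ ⟩
  suc (toℕ (cycPow k i)) % suc n     ≡⟨ cong (λ r → suc r % suc n) (toℕ-cycPow k i) ⟩
  suc ((toℕ i + k) % suc n) % suc n  ≡⟨ suc-%-suc (toℕ i + k) n ⟩
  suc (toℕ i + k) % suc n            ≡⟨ cong (_% suc n) (+-suc (toℕ i) k) ⟨
  (toℕ i + suc k) % suc n            ∎
  where open ≡-Reasoning

cycPow-≡ : ∀ {n} k (i j : Fin (suc n)) → (toℕ i + k) % suc n ≡ toℕ j % suc n → cycPow k i ≡ j
cycPow-≡ k i j eq =
  toℕ-injective (trans (toℕ-cycPow k i) (trans eq (m<n⇒m%n≡m (toℕ<n j))))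

round-up-to-even : ∀ E → ∃[ t ] t < 2 × ∃[ c ] c + c ≡ t + E
round-up-to-even E = t , m%n<n E 2 , t + E / 2 , (begin
  (t + E / 2) + (t + E / 2)  ≡⟨ double t (E / 2) ⟩
  t + (t + E / 2 * 2)        ≡⟨ cong (t +_) (m≡m%n+[m/n]*n E 2) ⟨
  t + E                      ∎)
  where
  open ≡-Reasoning
  t = E % 2
  double : ∀ t q → (t + q) + (t + q) ≡ t + (t + q * 2)
  double = solve-∀

%-≡-multiple : ∀ {a} t q n → a ≡ t + q * suc n → a % suc n ≡ t % suc n
%-≡-multiple t q n refl = [m+kn]%n≡m%n t q (suc n)

-- Modulo N = 1 + n, −x is represented by x * n.
triangle-shifts : ∀ n x y z t c → c + c ≡ t + (x + y * n + z * n) →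
  ∃[ k₀ ] ∃[ k₁ ] ∃[ k₂ ]
    (x + (k₀ + k₁)) % suc n ≡ t % suc n ×
    (y + (k₀ + k₂)) % suc n ≡ t % suc n ×
    (z + (k₁ + k₂)) % suc n ≡ t % suc n
triangle-shifts n x y z t c 2c≡ =
  y * n + t + c * n , x * n + y + c , c ,
  %-≡-multiple t (x + y + c) n sum₀₁ ,
  %-≡-multiple t (y + c) n sum₀₂ ,
  %-≡-multiple t (x + y + z) n sum₁₂
  where
  open ≡-Reasoning
  sum₀₁ : x + ((y * n + t + c * n) + (x * n + y + c)) ≡ t + (x + y + c) * suc n
  sum₀₁ = solve (n ∷ x ∷ y ∷ t ∷ c ∷ [])
  sum₀₂ : y + ((y * n + t + c * n) + c) ≡ t + (y + c) * suc n
  sum₀₂ = solve (n ∷ y ∷ t ∷ c ∷ [])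
  sum₁₂ : z + ((x * n + y + c) + c) ≡ t + (x + y + z) * suc n
  sum₁₂ = begin
    z + ((x * n + y + c) + c)                ≡⟨ solve (n ∷ x ∷ y ∷ z ∷ c ∷ []) ⟩
    z + x * n + y + (c + c)                  ≡⟨ cong (z + x * n + y +_) 2c≡ ⟩
    z + x * n + y + (t + (x + y * n + z * n)) ≡⟨ solve (n ∷ x ∷ y ∷ z ∷ t ∷ []) ⟩
    t + (x + y + z) * suc n                  ∎

triangle-congruences : ∀ n x y z → ∃[ t ] t < 2 × ∃[ k₀ ] ∃[ k₁ ] ∃[ k₂ ]
    (x + (k₀ + k₁)) % suc n ≡ t % suc n ×
    (y + (k₀ + k₂)) % suc n ≡ t % suc n ×
    (z + (k₁ + k₂)) % suc n ≡ t % suc n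
triangle-congruences n x y z with round-up-to-even (x + y * n + z * n)
... | t , t<2 , c , 2c≡ = t , t<2 , triangle-shifts n x y z t c 2c≡

switchCol-sym : ∀ {m n} (π : Fin m → Fin m) v (c : Colouring m n) x y →
  switchCol π v (col c) x y ≡ switchCol π v (col c) y x
switchCol-sym π v c x y rewrite ∨-comm (does (x ≟ᶠ v)) (does (y ≟ᶠ v)) | Colouring.sym c x y = refl

switch : ∀ {m n} → Colouring m n → Fin n → ℕ → Colouring m n
switch c v k = mkColouring (switchCol (cycPow k) v (col c)) (switchCol-sym (cycPow k) v c)

switch-CSwitch : ∀ {m n} (c : Colouring m n) v k → CSwitch c (switch c v k)
switch-CSwitch c v k = v , k , λ _ _ _ → refl

v₀ v₁ v₂ : Fin 3
v₀ = zero
v₁ = suc zero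
v₂ = suc (suc zero)

switchTriangle : ∀ {m} → Colouring m 3 → ℕ → ℕ → ℕ → Colouring m 3
switchTriangle c k₀ k₁ k₂ = switch (switch (switch c v₀ k₀) v₁ k₁) v₂ k₂

switchTriangle-CSwitchEquiv : ∀ {m} (c : Colouring m 3) k₀ k₁ k₂ →
  CSwitchEquiv c (switchTriangle c k₀ k₁ k₂)
switchTriangle-CSwitchEquiv c k₀ k₁ k₂ =
  _◅_ {j = c₁} (switch-CSwitch c v₀ k₀) (_◅_ {j = c₂} (switch-CSwitch c₁ v₁ k₁)
    (_◅_ {j = switch c₂ v₂ k₂} (switch-CSwitch c₂ v₂ k₂) ε))
  where
  c₁ = switch c v₀ k₀
  c₂ = switch c₁ v₁ k₁

triangle-ContainsMono : ∀ {m} (e : Colouring m 3) i →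
  col e v₀ v₁ ≡ i → col e v₀ v₂ ≡ i → col e v₁ v₂ ≡ i → ContainsMono e 3 i
triangle-ContainsMono e i e₀₁ e₀₂ e₁₂ = (λ p → p) , (λ eq → eq) , edges
  where
  edges : ∀ p q → ¬ p ≡ q → col e p q ≡ i
  edges zero             zero             p≢q = ⊥-elim (p≢q refl)
  edges zero             (suc zero)       _   = e₀₁
  edges zero             (suc (suc zero)) _   = e₀₂
  edges (suc zero)       zero             _   = trans (Colouring.sym e v₁ v₀) e₀₁
  edges (suc zero)       (suc zero)       p≢q = ⊥-elim (p≢q refl)
  edges (suc zero)       (suc (suc zero)) _   = e₁₂
  edges (suc (suc zero)) zero             _   = trans (Colouring.sym e v₂ v₀) e₀₂
  edges (suc (suc zero)) (suc zero)       _   = trans (Colouring.sym e v₂ v₁) e₁₂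
  edges (suc (suc zero)) (suc (suc zero)) p≢q = ⊥-elim (p≢q refl)

switchTriangle-ContainsMono : ∀ {n} (c : Colouring (suc n) 3) k₀ k₁ k₂ (i : Fin (suc n)) →
  (toℕ (col c v₀ v₁) + (k₀ + k₁)) % suc n ≡ toℕ i % suc n →
  (toℕ (col c v₀ v₂) + (k₀ + k₂)) % suc n ≡ toℕ i % suc n →
  (toℕ (col c v₁ v₂) + (k₁ + k₂)) % suc n ≡ toℕ i % suc n →
  ContainsMono (switchTriangle c k₀ k₁ k₂) 3 i
switchTriangle-ContainsMono c k₀ k₁ k₂ i s₀₁ s₀₂ s₁₂ =
  triangle-ContainsMono (switchTriangle c k₀ k₁ k₂) i
  (trans (cycPow-+ k₁ k₀ (col c v₀ v₁)) (cycPow-≡ (k₀ + k₁) (col c v₀ v₁) i s₀₁))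
  (trans (cycPow-+ k₂ k₀ (col c v₀ v₂)) (cycPow-≡ (k₀ + k₂) (col c v₀ v₂) i s₀₂))
  (trans (cycPow-+ k₂ k₁ (col c v₁ v₂)) (cycPow-≡ (k₁ + k₂) (col c v₁ v₂) i s₁₂))

triangle-switchable-mono : ∀ {n} (c : Colouring (suc (suc n)) 3) →
  ∃[ e ] CSwitchEquiv c e × ∃[ i ] toℕ i < 2 × ContainsMono e 3 i
triangle-switchable-mono {n} c
  with triangle-congruences (suc n) (toℕ (col c v₀ v₁)) (toℕ (col c v₀ v₂)) (toℕ (col c v₁ v₂))
... | t , t<2 , k₀ , k₁ , k₂ , s₀₁ , s₀₂ , s₁₂ =
  switchTriangle c k₀ k₁ k₂ , switchTriangle-CSwitchEquiv c k₀ k₁ k₂ ,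
  T , subst (_< 2) (≡-sym toℕT≡t) t<2 ,
  switchTriangle-ContainsMono c k₀ k₁ k₂ T (atT s₀₁) (atT s₀₂) (atT s₁₂)
  where
  t<m : t < suc (suc n)
  t<m = <-≤-trans t<2 (s≤s (s≤s z≤n))
  T = fromℕ< t<m
  toℕT≡t : toℕ T ≡ t
  toℕT≡t = toℕ-fromℕ< t<m
  atT : ∀ {r} → r ≡ t % suc (suc n) → r ≡ toℕ T % suc (suc n)
  atT r≡t = trans r≡t (cong (_% suc (suc n)) (≡-sym toℕT≡t))

ContainsMono⇒≤ : ∀ {m n} {c : Colouring m n} {t i} → ContainsMono c t i → t ≤ n
ContainsMono⇒≤ {n = n} {t = t} (f , f-injective , _) with ≤-<-connex t n
... | inj₁ t≤n = t≤n
... | inj₂ n<t with pigeonhole n<t f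
...   | p , q , p<q , fp≡fq = ⊥-elim (<-irrefl (f-injective fp≡fq) p<q)

CRamseyProp⇒∃≤ : ∀ {m} (a : Fin (suc m) → ℕ) {n} → CRamseyProp a n → ∃[ i ] a i ≤ n
CRamseyProp⇒∃≤ a P with P (mkColouring (λ _ _ → zero) (λ _ _ → refl))
... | e , _ , i , mono = i , ContainsMono⇒≤ {c = e} mono

CRamseyProp-3 : ∀ {n} (a : Fin (suc (suc n)) → ℕ) → (∀ i → toℕ i < 2 → a i ≡ 3) → CRamseyProp a 3
CRamseyProp-3 a a≡3 c with triangle-switchable-mono c
... | e , c~e , i , i<2 , mono =
  e , c~e , i , subst (λ s → ContainsMono e s i) (≡-sym (a≡3 i i<2)) mono

corollary20 : (m : ℕ) → 2 ≤ m → 2 ∣ m → (a : Fin m → ℕ) →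
    (∀ i → 2 ≤ toℕ i → a i ≥ 3) →
    (∀ i → toℕ i ≡ 0 → a i ≡ 3) → (∀ i → toℕ i ≡ 1 → a i ≡ 3) →
    CRamseyIs a 3
corollary20 (suc (suc m)) (s≤s (s≤s z≤n)) _ a a≥3 a₀≡3 a₁≡3 = CRamseyProp-3 a a≡3 , below-3
  where
  a≡3 : ∀ i → toℕ i < 2 → a i ≡ 3
  a≡3 i i<2 with toℕ i in eq
  a≡3 i _              | zero     = a₀≡3 i eq
  a≡3 i _              | suc zero = a₁≡3 i eq
  a≡3 i (s≤s (s≤s ())) | suc (suc _)

  all-≥3 : ∀ i → a i ≥ 3
  all-≥3 i with toℕ i in eq
  ... | zero        = ≤-reflexive (≡-sym (a₀≡3 i eq))
  ... | suc zero    = ≤-reflexive (≡-sym (a₁≡3 i eq))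
  ... | suc (suc _) = a≥3 i (subst (2 ≤_) (≡-sym eq) (s≤s (s≤s z≤n)))

  below-3 : ∀ n → n < 3 → ¬ CRamseyProp a n
  below-3 n n<3 P with CRamseyProp⇒∃≤ a P
  ... | i , aᵢ≤n = n≮n n (<-≤-trans n<3 (≤-trans (all-≥3 i) aᵢ≤n))
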